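{- For any integer $k\ge 2$, there is a constant $c_k>0$ such that if $G$ is an interval graph with $n$ vertices containing a Hamiltonian path and $G$ has maximum clique size $k$, then $G$ has an induced path of size at least $c_k (\log n)^{\frac{1}{(k-1)^2}}$.
   Context: An interval graph is the intersection graph of a family of closed intervals on the real line. The size of a path is its number of vertices. Logarithms are base 2.
   Formalization: The closed intervals representing G have rational endpoints rather than arbitrary endpoints on the real line. -}

module Defs where

open import Level using (0ℓ)
open import Data.Nat using (ℕ; suc; _≤_; _*_; _^_; _∸_)
open import Data.Fin using (Fin; toℕ)
open import Data.Product using (Σ; _×_; ∃; ∃-syntax)
open import Data.Sum using (_⊎_)
open import Data.Rational as ℚ using (ℚ)
open import Relation.Binary.PropositionalEquality using (_≡_; _≢_)
open import Relation.Nullary using (¬_)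
open import Function.Definitions using (Injective)
open import Function.Bundles using (_⇔_)

record Graph (n : ℕ) : Set₁ where
  field
    Adj    : Fin n → Fin n → Set
    sym    : ∀ {u v} → Adj u v → Adj v u
    irrefl : ∀ {v} → ¬ Adj v v
open Graph public

-- Endpoints are taken
-- rational (any finite family of real intervals has the same intersection
-- pattern as a family with rational endpoints).
-- [a,b] ∩ [c,d] ≠ ∅  ⇔  a ≤ d and c ≤ b.
IsIntervalGraph : ∀ {n} → Graph n → Set
IsIntervalGraph {n} G =
  Σ (Fin n → ℚ) λ l → Σ (Fin n → ℚ) λ r →
    (∀ v → l v ℚ.≤ r v) ×
    (∀ u v → u ≢ v → (Adj G u v ⇔ (l u ℚ.≤ r v × l v ℚ.≤ r u)))

IsPath : ∀ {n m} → Graph n → (Fin m → Fin n) → Set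
IsPath {n} {m} G p =
  Injective _≡_ _≡_ p ×
  (∀ (i j : Fin m) → toℕ j ≡ suc (toℕ i) → Adj G (p i) (p j))

IsInducedPath : ∀ {n m} → Graph n → (Fin m → Fin n) → Set
IsInducedPath {n} {m} G p =
  IsPath G p ×
  (∀ (i j : Fin m) → Adj G (p i) (p j) →
     toℕ j ≡ suc (toℕ i) ⊎ toℕ i ≡ suc (toℕ j))

HasHamiltonianPath : ∀ {n} → Graph n → Set
HasHamiltonianPath {n} G =
  Σ (Fin n → Fin n) λ p → IsPath G p × (∀ v → ∃[ i ] p i ≡ v)

IsClique : ∀ {n m} → Graph n → (Fin m → Fin n) → Set
IsClique {n} {m} G q =
  Injective _≡_ _≡_ q × (∀ i j → i ≢ j → Adj G (q i) (q j))

MaxCliqueSize : ∀ {n} → Graph n → ℕ → Set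
MaxCliqueSize {n} G k =
  (Σ (Fin k → Fin n) λ q → IsClique G q) ×
  (∀ m (q : Fin m → Fin n) → IsClique G q → m ≤ k)

{-# OPTIONS --safe #-}
-- Number the vertices along the Hamiltonian path, so that consecutive intervals meet, and
-- suppose no induced path ascending in this order has more than M vertices.  By induction on
-- j, every window [a, b) of consecutive vertices with clique number at most j then has fewer
-- than (M+1)^j vertices.  In a window take a vertex u whose interval ends first and a vertex v
-- whose interval starts last, and join them by the greedy path that always jumps to the
-- farthest vertex still meeting the current one; it is induced.  The intervals of a clique
-- share a subinterval (Helly), which the chain of path intervals running from u to v must
-- meet, so a clique in a gap of the path (before it, between consecutive path vertices, or
-- after it) extends by a path vertex.  Hence each of the at most M+1 gaps has clique number
-- below j.  For the whole graph this gives n < (m+1)^k for the size m of some induced path,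
-- which is much stronger than the logarithmic bound.
module Submission where

open import Defs
open import Data.Nat using (ℕ; _≤_; _*_; _^_; _∸_)
open import Data.Fin using (Fin)
open import Data.Product using (Σ; _×_)

open import Level using (0ℓ)
open import Data.Nat using (zero; suc; _+_; _<_; z≤n; s≤s; s≤s⁻¹; z<s; _<?_; _≤?_; NonZero)
open import Data.Nat.Properties
open import Data.Nat.DivMod using (_mod_; m<n⇒m%n≡m)
open import Data.Nat.Solver using (module +-*-Solver)
import Data.Fin as Fin
open import Data.Fin using (zero; suc; toℕ)
open import Data.Fin.Properties using (toℕ-fromℕ<; toℕ-injective; toℕ<n; injective⇒≤)
open import Data.Product using (Σ-syntax; ∃-syntax; _,_; proj₁; proj₂; swap)
open import Data.Sum as Sum using (_⊎_; inj₁; inj₂)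
import Data.Sum.Effectful.Left as Sumₗ
open import Effect.Monad using (RawMonad)
open import Data.Empty using (⊥; ⊥-elim)
open import Data.List using (allFin)
open import Data.List.Relation.Unary.All using (lookup)
open import Data.List.Membership.Propositional.Properties using (∈-allFin)
open import Data.Vec.Functional using (_∷_)
open import Data.Rational as ℚ using (ℚ)
import Data.Rational.Properties as ℚₚ
open import Relation.Nullary using (¬_; Dec; yes; no; contradiction)
open import Relation.Nullary.Decidable using (_×-dec_)
open import Relation.Unary using (Decidable)
open import Relation.Binary.Bundles using (TotalPreorder; DecTotalOrder)
open import Relation.Binary.Definitions using (tri<; tri≈; tri>)
import Relation.Binary.Construct.Flip.EqAndOrd as Flip
open import Relation.Binary.PropositionalEquality as ≡ using (_≡_; _≢_; refl; trans; cong; subst)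
open import Data.List.Extrema (DecTotalOrder.totalOrder ℚₚ.≤-decTotalOrder)
  using (argmin; argmax; f[argmin]≤f[xs]; f[xs]≤f[argmax])
open import Function using (_∘_)
open import Function.Bundles using (_⇔_; Equivalence)
open import Function.Definitions using (Injective)

greatest-below : ∀ {P : ℕ → Set} → Decidable P → ∀ {a} b → a ≤ b → P a →
  ∃[ e ] a ≤ e × e ≤ b × P e × (∀ {e′} → e < e′ → e′ ≤ b → ¬ P e′)
greatest-below P? b a≤b pa with P? b
... | yes pb = b , a≤b , ≤-refl , pb , λ b<e′ e′≤b _ → <-irrefl refl (<-≤-trans b<e′ e′≤b)
greatest-below P? zero z≤n pa | no ¬pb = contradiction pa ¬pb
greatest-below P? (suc b) a≤1+b pa | no ¬pb with m≤n⇒m<n∨m≡n a≤1+b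
... | inj₂ refl = contradiction pa ¬pb
... | inj₁ a<1+b with greatest-below P? b (s≤s⁻¹ a<1+b) pa
...   | e , a≤e , e≤b , pe , beyond = e , a≤e , m≤n⇒m≤1+n e≤b , pe , beyond′
  where
  beyond′ : ∀ {e′} → e < e′ → e′ ≤ suc b → ¬ _
  beyond′ e<e′ e′≤1+b with m≤n⇒m<n∨m≡n e′≤1+b
  ... | inj₁ e′<1+b = beyond e<e′ (s≤s⁻¹ e′<1+b)
  ... | inj₂ refl   = ¬pb

fuel-suffices : ∀ {N fuel c e} → N ≤ suc fuel + c → c < e → N ≤ fuel + e
fuel-suffices {fuel = fuel} {c} N≤1+fuel+c c<e =
  ≤-trans N≤1+fuel+c (≤-trans (≤-reflexive (≡.sym (+-suc fuel c))) (+-monoʳ-≤ fuel c<e))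

InWindow : ℕ → ℕ → ℕ → Set
InWindow a b w = a ≤ w × w < b

module _ (O : TotalPreorder 0ℓ 0ℓ 0ℓ) where
  open TotalPreorder O using (Carrier; _≲_; total) renaming (refl to ≲-refl; trans to ≲-trans)

  argmin-window : (f : ℕ → Carrier) → ∀ {a} b → a < b →
    ∃[ u ] InWindow a b u × (∀ w → InWindow a b w → f u ≲ f w)
  argmin-window f {a} (suc b) a<1+b with m≤n⇒m<n∨m≡n (s≤s⁻¹ a<1+b)
  ... | inj₂ refl = a , (≤-refl , ≤-refl) , only-a
    where
    only-a : ∀ w → InWindow a (suc a) w → f a ≲ f w
    only-a w (a≤w , w<1+a) with ≤-antisym a≤w (s≤s⁻¹ w<1+a)
    ... | refl = ≲-refl
  ... | inj₁ a<b with argmin-window f b a<b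
  ...   | u , (a≤u , u<b) , least with total (f u) (f b)
  ...     | inj₁ fu≲fb = u , (a≤u , m<n⇒m<1+n u<b) , least′
    where
    least′ : ∀ w → InWindow a (suc b) w → f u ≲ f w
    least′ w (a≤w , w<1+b) with m<1+n⇒m<n∨m≡n w<1+b
    ... | inj₁ w<b = least w (a≤w , w<b)
    ... | inj₂ refl = fu≲fb
  ...     | inj₂ fb≲fu = b , (<⇒≤ a<b , ≤-refl) , least′
    where
    least′ : ∀ w → InWindow a (suc b) w → f b ≲ f w
    least′ w (a≤w , w<1+b) with m<1+n⇒m<n∨m≡n w<1+b
    ... | inj₁ w<b = ≲-trans fb≲fu (least w (a≤w , w<b))
    ... | inj₂ refl = ≲-refl

lower-witness : ∀ (P : ℕ → Set) {s} → (P (suc s) → P s) →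
  ∃[ i ] i ≤ suc s × P i → ∃[ i ] i ≤ s × P i
lower-witness P {s} back (i , i≤1+s , pi) with m≤n⇒m<n∨m≡n i≤1+s
... | inj₁ i<1+s = i , s≤s⁻¹ i<1+s , pi
... | inj₂ refl  = s , ≤-refl , back pi

∷-injective : ∀ {A : Set} {m} {c : A} {K : Fin m → A} →
  (∀ x → K x ≢ c) → Injective _≡_ _≡_ K → Injective _≡_ _≡_ (c ∷ K)
∷-injective fresh inj {zero}  {zero}  _ = refl
∷-injective fresh inj {zero}  {suc y} c≡Ky = contradiction (≡.sym c≡Ky) (fresh y)
∷-injective fresh inj {suc x} {zero}  Kx≡c = contradiction Kx≡c (fresh x)
∷-injective fresh inj {suc x} {suc y} Kx≡Ky = cong suc (inj Kx≡Ky)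

module Intervals {I : Set} (L R : I → ℚ) where

  Meets : I → I → Set
  Meets i j = L i ℚ.≤ R j × L j ℚ.≤ R i

  meets? : ∀ i j → Dec (Meets i j)
  meets? i j = (L i ℚ.≤? R j) ×-dec (L j ℚ.≤? R i)

  PairwiseMeeting : ∀ {m} → (Fin m → I) → Set
  PairwiseMeeting K = ∀ x y → x ≢ y → Meets (K x) (K y)

  ∷-pairwiseMeeting : ∀ {m c} {K : Fin m → I} →
    (∀ x → Meets c (K x)) → PairwiseMeeting K → PairwiseMeeting (c ∷ K)
  ∷-pairwiseMeeting c-meets K-meets zero    zero    0≢0 = contradiction refl 0≢0
  ∷-pairwiseMeeting c-meets K-meets zero    (suc y) _   = c-meets y
  ∷-pairwiseMeeting c-meets K-meets (suc x) zero    _   = swap (c-meets x)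
  ∷-pairwiseMeeting c-meets K-meets (suc x) (suc y) x≢y =
    K-meets x y (x≢y ∘ cong suc)

  Chain : (ℕ → I) → ℕ → Set
  Chain c s = ∀ t → t < s → Meets (c t) (c (suc t))

  _Meets[_,_] : I → ℚ → ℚ → Set
  i Meets[ X , Y ] = L i ℚ.≤ Y × X ℚ.≤ R i

  chain-meets-interval : ∀ {X Y} → X ℚ.≤ Y → (c : ℕ → I) → ∀ s → Chain c s →
    ∃[ i ] i ≤ s × L (c i) ℚ.≤ Y → ∃[ j ] j ≤ s × X ℚ.≤ R (c j) →
    ∃[ t ] t ≤ s × c t Meets[ X , Y ]
  chain-meets-interval X≤Y c zero _ (_ , z≤n , Li≤Y) (_ , z≤n , X≤Rj) = 0 , z≤n , Li≤Y , X≤Rj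
  chain-meets-interval {X} {Y} X≤Y c (suc s) chain i j =
    check (L (c (suc s)) ℚ.≤? Y) (X ℚ.≤? R (c (suc s)))
    where
    link : Meets (c s) (c (suc s))
    link = chain s ≤-refl
    recurse : ∃[ i ] i ≤ s × L (c i) ℚ.≤ Y → ∃[ j ] j ≤ s × X ℚ.≤ R (c j) →
              ∃[ t ] t ≤ suc s × c t Meets[ X , Y ]
    recurse i′ j′ with chain-meets-interval X≤Y c s (λ t t<s → chain t (m<n⇒m<1+n t<s)) i′ j′
    ... | t , t≤s , meets = t , m≤n⇒m≤1+n t≤s , meets
    -- If the last interval misses [X, Y], it lies beyond one end of it, and then
    -- its predecessor, which meets it, reaches past that end.
    check : Dec (L (c (suc s)) ℚ.≤ Y) → Dec (X ℚ.≤ R (c (suc s))) →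
            ∃[ t ] t ≤ suc s × c t Meets[ X , Y ]
    check (yes L≤Y) (yes X≤R) = suc s , ≤-refl , L≤Y , X≤R
    check (no L≰Y) _ = recurse
      (lower-witness _ (λ L≤Y → contradiction L≤Y L≰Y) i)
      (lower-witness _ (λ _ → ℚₚ.<⇒≤ (ℚₚ.≤-<-trans X≤Y
                                      (ℚₚ.<-≤-trans (ℚₚ.≰⇒> L≰Y) (proj₂ link)))) j)
    check (yes _) (no X≰R) = recurse
      (lower-witness _ (λ _ → ℚₚ.<⇒≤ (ℚₚ.≤-<-trans (proj₁ link)
                                      (ℚₚ.<-≤-trans (ℚₚ.≰⇒> X≰R) X≤Y))) i)
      (lower-witness _ (λ X≤R → contradiction X≤R X≰R) j)

  helly : (∀ i → L i ℚ.≤ R i) → ∀ {m} (K : Fin (suc m) → I) → PairwiseMeeting K →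
    ∃[ x₀ ] ∃[ x₁ ] L (K x₀) ℚ.≤ R (K x₁) ×
                    (∀ x → L (K x) ℚ.≤ L (K x₀) × R (K x₁) ℚ.≤ R (K x))
  helly L≤R {m} K K-meets = x₀ , x₁ , starts≤ends x₀ x₁ ,
    λ x → lookup (f[xs]≤f[argmax] {f = L ∘ K} zero (allFin _)) (∈-allFin x) ,
          lookup (f[argmin]≤f[xs] {f = R ∘ K} zero (allFin _)) (∈-allFin x)
    where
    x₀ x₁ : Fin (suc m)
    x₀ = argmax (L ∘ K) zero (allFin _)
    x₁ = argmin (R ∘ K) zero (allFin _)
    starts≤ends : ∀ x y → L (K x) ℚ.≤ R (K y)
    starts≤ends x y with x Fin.≟ y
    ... | yes refl = L≤R (K x)
    ... | no x≢y   = proj₁ (K-meets x y x≢y)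

  chain-meets-clique : (∀ i → L i ℚ.≤ R i) → (c : ℕ → I) → ∀ s → Chain c s →
    ∀ {m} (K : Fin (suc m) → I) → PairwiseMeeting K →
    ∃[ i ] i ≤ s × (∀ x → L (c i) ℚ.≤ R (K x)) →
    ∃[ j ] j ≤ s × (∀ x → L (K x) ℚ.≤ R (c j)) →
    ∃[ t ] t ≤ s × (∀ x → Meets (c t) (K x))
  chain-meets-clique L≤R c s chain K K-meets (i , i≤s , left) (j , j≤s , right) =
    let x₀ , x₁ , X≤Y , spans = helly L≤R K K-meets
        t , t≤s , Lt≤Y , X≤Rt =
          chain-meets-interval X≤Y c s chain (i , i≤s , left x₁) (j , j≤s , right x₀)
    in t , t≤s , λ x → ℚₚ.≤-trans Lt≤Y (proj₂ (spans x)) , ℚₚ.≤-trans (proj₁ (spans x)) X≤Rt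

window-arithmetic : ∀ {a α β b s T M} → α < a + T → β ≤ α + s * T → b < suc β + T → suc s ≤ M →
  b < a + suc M * T
window-arithmetic {a} {α} {β} {b} {s} {T} {M} α<a+T β≤ b< 1+s≤M = begin-strict
  b                       <⟨ b< ⟩
  suc β + T               ≤⟨ +-monoˡ-≤ T (s≤s β≤) ⟩
  suc α + s * T + T       ≤⟨ +-monoˡ-≤ T (+-monoˡ-≤ (s * T) α<a+T) ⟩
  a + T + s * T + T       ≡⟨ regroup ⟩
  a + suc (suc s) * T     ≤⟨ +-monoʳ-≤ a (*-monoˡ-≤ T (s≤s 1+s≤M)) ⟩
  a + suc M * T           ∎
  where
  open ≤-Reasoning
  open +-*-Solver
  regroup : a + T + s * T + T ≡ a + suc (suc s) * T
  regroup = solve 3 (λ a T s → a :+ T :+ s :* T :+ T := a :+ (con 2 :+ s) :* T) refl a T s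

module IntervalSequence (n : ℕ) (L R : ℕ → ℚ) (L≤R : ∀ i → L i ℚ.≤ R i)
  (consecutive-meet : ∀ i → suc i < n → Intervals.Meets L R i (suc i)) where

  open Intervals L R

  record AscendingInducedPath (m : ℕ) (p : ℕ → ℕ) : Set where
    field
      ascending : ∀ x y → x < y → y < m → p x < p y
      bounded   : ∀ x → x < m → p x < n
      edges     : ∀ x → suc x < m → Meets (p x) (p (suc x))
      chordless : ∀ x y → x < y → y < m → Meets (p x) (p y) → y ≡ suc x

    monotone : ∀ x y → x ≤ y → y < m → p x ≤ p y
    monotone x y x≤y y<m with m≤n⇒m<n∨m≡n x≤y
    ... | inj₁ x<y  = <⇒≤ (ascending x y x<y y<m)
    ... | inj₂ refl = ≤-refl

  InducedPathLongerThan : ℕ → Set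
  InducedPathLongerThan M = ∃[ m ] M < m × Σ[ p ∈ (ℕ → ℕ) ] AscendingInducedPath m p

  record InducedPathBetween (α β : ℕ) : Set where
    field
      last    : ℕ
      path    : ℕ → ℕ
      induced : AscendingInducedPath (suc last) path
      starts  : path 0 ≡ α
      ends    : path last ≡ β
      within  : ∀ x → x ≤ last → α ≤ path x × path x ≤ β
    open AscendingInducedPath induced public

  SomeVertexOf : ∀ {α β} → InducedPathBetween α β → (ℕ → Set) → Set
  SomeVertexOf P Q = ∃[ x ] x ≤ last × Q (path x)
    where open InducedPathBetween P

  start-vertex : ∀ {α β} (P : InducedPathBetween α β) {Q : ℕ → Set} → Q α → SomeVertexOf P Q
  start-vertex P {Q} qα = 0 , z≤n , subst Q (≡.sym (InducedPathBetween.starts P)) qα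

  end-vertex : ∀ {α β} (P : InducedPathBetween α β) {Q : ℕ → Set} → Q β → SomeVertexOf P Q
  end-vertex P {Q} qβ =
    InducedPathBetween.last P , ≤-refl , subst Q (≡.sym (InducedPathBetween.ends P)) qβ

  single-vertex : ∀ {β} → β < n → InducedPathBetween β β
  single-vertex {β} β<n = record
    { last = 0 ; path = λ _ → β ; induced = induced
    ; starts = refl ; ends = refl ; within = λ _ _ → ≤-refl , ≤-refl }
    where
    induced : AscendingInducedPath 1 (λ _ → β)
    induced = record
      { ascending = λ { _ zero () _ ; _ (suc _) _ (s≤s ()) }
      ; bounded   = λ _ _ → β<n
      ; edges     = λ { _ (s≤s ()) }
      ; chordless = λ { _ zero () _ _ ; _ (suc _) _ (s≤s ()) _ } }

  prepend : ∀ {c e β} → c < e → Meets c e → (∀ {e′} → e < e′ → e′ ≤ β → ¬ Meets c e′) →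
    InducedPathBetween e β → InducedPathBetween c β
  prepend {c} {e} {β} c<e c-meets-e beyond P = record
    { last = suc last ; path = path′ ; induced = induced′
    ; starts = refl ; ends = ends ; within = within′ }
    where
    open InducedPathBetween P
    path′ : ℕ → ℕ
    path′ zero    = c
    path′ (suc x) = path x
    within′ : ∀ x → x ≤ suc last → c ≤ path′ x × path′ x ≤ β
    within′ zero    _       = ≤-refl , ≤-trans (<⇒≤ c<e) (subst (_≤ β) starts (proj₂ (within 0 z≤n)))
    within′ (suc x) 1+x≤1+l =
      ≤-trans (<⇒≤ c<e) (proj₁ (within x (s≤s⁻¹ 1+x≤1+l))) , proj₂ (within x (s≤s⁻¹ 1+x≤1+l))
    e<path : ∀ y → suc y < suc last → e < path (suc y)
    e<path y 1+y<1+l = subst (_< path (suc y)) starts (ascending 0 (suc y) z<s 1+y<1+l)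
    induced′ : AscendingInducedPath (suc (suc last)) path′
    AscendingInducedPath.ascending induced′ zero    zero    ()      _
    AscendingInducedPath.ascending induced′ zero    (suc y) _       y<  =
      <-≤-trans c<e (proj₁ (within y (s≤s⁻¹ (s≤s⁻¹ y<))))
    AscendingInducedPath.ascending induced′ (suc x) zero    ()      _
    AscendingInducedPath.ascending induced′ (suc x) (suc y) 1+x<1+y y<  =
      ascending x y (s≤s⁻¹ 1+x<1+y) (s≤s⁻¹ y<)
    AscendingInducedPath.bounded   induced′ zero    _  = <-trans c<e (subst (_< n) starts (bounded 0 z<s))
    AscendingInducedPath.bounded   induced′ (suc x) x< = bounded x (s≤s⁻¹ x<)
    AscendingInducedPath.edges     induced′ zero    _  = subst (Meets c) (≡.sym starts) c-meets-e
    AscendingInducedPath.edges     induced′ (suc x) x< = edges x (s≤s⁻¹ x<)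
    AscendingInducedPath.chordless induced′ zero    zero          ()      _  _
    AscendingInducedPath.chordless induced′ zero    (suc zero)    _       _  _ = refl
    AscendingInducedPath.chordless induced′ zero    (suc (suc y)) _       y< c-meets =
      contradiction c-meets
        (beyond (e<path y (s≤s⁻¹ y<)) (proj₂ (within (suc y) (s≤s⁻¹ (s≤s⁻¹ y<)))))
    AscendingInducedPath.chordless induced′ (suc x) zero          ()      _  _
    AscendingInducedPath.chordless induced′ (suc x) (suc y)       1+x<1+y y< meets =
      cong suc (chordless x y (s≤s⁻¹ 1+x<1+y) (s≤s⁻¹ y<) meets)

  greedy-path : ∀ {α β} → α ≤ β → β < n → InducedPathBetween α β
  greedy-path {α} {β} α≤β β<n = go β α≤β (m≤m+n β α)
    where
    go : ∀ fuel {c} → c ≤ β → β ≤ fuel + c → InducedPathBetween c β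
    go fuel {c} c≤β β≤fuel+c with m≤n⇒m<n∨m≡n c≤β
    ... | inj₂ refl = single-vertex β<n
    go zero       c≤β β≤c | inj₁ c<β = contradiction c<β (≤⇒≯ β≤c)
    go (suc fuel) {c} c≤β β≤fuel+c | inj₁ c<β
      with greatest-below (meets? c) β c<β (consecutive-meet c (<-≤-trans (s≤s c<β) β<n))
    ... | e , c<e , e≤β , c-meets-e , beyond =
      prepend c<e c-meets-e beyond (go fuel e≤β (fuel-suffices β≤fuel+c c<e))

  CliqueNumber≤ : ℕ → ℕ → ℕ → Set
  CliqueNumber≤ a b j = ∀ m (K : Fin m → ℕ) → Injective _≡_ _≡_ K →
    (∀ x → InWindow a b (K x)) → PairwiseMeeting K → m ≤ j

  WindowBound : ℕ → Set
  WindowBound j = ∀ M a b → b ≤ n → CliqueNumber≤ a b j →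
    InducedPathLongerThan M ⊎ b < a + suc M ^ j

  EndsFirstIn : ℕ → ℕ → ℕ → Set
  EndsFirstIn a b u = ∀ w → InWindow a b w → R u ℚ.≤ R w

  StartsLastIn : ℕ → ℕ → ℕ → Set
  StartsLastIn a b v = ∀ w → InWindow a b w → L w ℚ.≤ L v

  module WindowStep {j a b α β} (cliques : CliqueNumber≤ a b (suc j))
    (P : InducedPathBetween α β) (a≤α : a ≤ α) (β<b : β < b)
    (earliest-end : SomeVertexOf P (EndsFirstIn a b))
    (latest-start : SomeVertexOf P (StartsLastIn a b))
    where
    open InducedPathBetween P

    PathAvoids : ℕ → ℕ → Set
    PathAvoids x y = ∀ z → z ≤ last → x ≤ path z → path z < y → ⊥

    path-meets-clique : ∀ {m} (K : Fin (suc m) → ℕ) → (∀ x → InWindow a b (K x)) → PairwiseMeeting K →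
      ∃[ z ] z ≤ last × (∀ x → Meets (path z) (K x))
    path-meets-clique K K-in K-meets =
      let i , i≤last , earliest = earliest-end
          i′ , i′≤last , latest = latest-start
      in chain-meets-clique L≤R path last (λ t t<last → edges t (s≤s t<last)) K K-meets
           (i  , i≤last  , λ x → ℚₚ.≤-trans (L≤R (path i)) (earliest (K x) (K-in x)))
           (i′ , i′≤last , λ x → ℚₚ.≤-trans (latest (K x) (K-in x)) (L≤R (path i′)))

    gap-clique-number : ∀ {x y} → a ≤ x → y ≤ b → PathAvoids x y → CliqueNumber≤ x y j
    gap-clique-number _ _ _ zero _ _ _ _ = z≤n
    gap-clique-number {x} {y} a≤x y≤b avoids (suc m) K K-inj K-in K-meets =
      let z , z≤last , z-meets = path-meets-clique K K-in′ K-meets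
          fresh : ∀ i → K i ≢ path z
          fresh i Ki≡pz =
            avoids z z≤last (subst (x ≤_) Ki≡pz (proj₁ (K-in i))) (subst (_< y) Ki≡pz (proj₂ (K-in i)))
      in s≤s⁻¹ (cliques _ (path z ∷ K) (∷-injective fresh K-inj) (in-window z z≤last)
                         (∷-pairwiseMeeting z-meets K-meets))
      where
      K-in′ : ∀ i → InWindow a b (K i)
      K-in′ i = ≤-trans a≤x (proj₁ (K-in i)) , <-≤-trans (proj₂ (K-in i)) y≤b
      in-window : ∀ z → z ≤ last → ∀ i → InWindow a b ((path z ∷ K) i)
      in-window z z≤last zero    =
        ≤-trans a≤α (proj₁ (within z z≤last)) , ≤-<-trans (proj₂ (within z z≤last)) β<b
      in-window z z≤last (suc i) = K-in′ i

    module _ (M : ℕ) (b≤n : b ≤ n) (ih : WindowBound j) where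
      open RawMonad (Sumₗ.monad (InducedPathLongerThan M) 0ℓ) using (_>>=_; pure)

      T : ℕ
      T = suc M ^ j

      gap-bound : ∀ {x y} → a ≤ x → y ≤ b → PathAvoids x y → InducedPathLongerThan M ⊎ y < x + T
      gap-bound a≤x y≤b avoids = ih M _ _ (≤-trans y≤b b≤n) (gap-clique-number a≤x y≤b avoids)

      path-spread : ∀ t → t ≤ last → InducedPathLongerThan M ⊎ path t ≤ α + t * T
      path-spread zero    _         = pure (≤-trans (≤-reflexive starts) (m≤m+n α 0))
      path-spread (suc t) 1+t≤last = do
        pt≤ ← path-spread t t≤last
        next< ← gap-bound a≤1+pt (<⇒≤ (≤-<-trans (proj₂ (within (suc t) 1+t≤last)) β<b)) between
        pure (begin
          path (suc t)      ≤⟨ s≤s⁻¹ next< ⟩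
          path t + T        ≤⟨ +-monoˡ-≤ T pt≤ ⟩
          α + t * T + T     ≡⟨ +-assoc α (t * T) T ⟩
          α + (t * T + T)   ≡⟨ cong (α +_) (+-comm (t * T) T) ⟩
          α + suc t * T     ∎)
        where
        open ≤-Reasoning
        t≤last : t ≤ last
        t≤last = ≤-trans (n≤1+n t) 1+t≤last
        a≤1+pt : a ≤ suc (path t)
        a≤1+pt = ≤-trans a≤α (≤-trans (proj₁ (within t t≤last)) (n≤1+n _))
        between : PathAvoids (suc (path t)) (path (suc t))
        between z z≤last pt<pz pz<pt′ with z ≤? t
        ... | yes z≤t = <-irrefl refl (<-≤-trans pt<pz (monotone z t z≤t (s≤s t≤last)))
        ... | no z≰t  = <-irrefl refl (<-≤-trans pz<pt′ (monotone (suc t) z (≰⇒> z≰t) (s≤s z≤last)))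

      window-bound-step : InducedPathLongerThan M ⊎ b < a + suc M ^ suc j
      window-bound-step with M <? suc last
      ... | yes M<1+last = inj₁ (suc last , M<1+last , path , induced)
      ... | no M≮1+last = do
        α<a+T ← gap-bound ≤-refl (<⇒≤ (≤-<-trans α≤β β<b)) below-α
        β≤ ← path-spread last ≤-refl
        b<1+β+T ← gap-bound (≤-trans a≤α (≤-trans α≤β (n≤1+n β))) ≤-refl above-β
        pure (window-arithmetic α<a+T (subst (_≤ α + last * T) ends β≤) b<1+β+T (≮⇒≥ M≮1+last))
        where
        α≤β : α ≤ β
        α≤β = ≤-trans (≤-reflexive (≡.sym starts)) (proj₂ (within 0 z≤n))
        below-α : PathAvoids a α
        below-α z z≤last _ pz<α = <-irrefl refl (<-≤-trans pz<α (proj₁ (within z z≤last)))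
        above-β : PathAvoids (suc β) b
        above-β z z≤last β<pz _ = <-irrefl refl (≤-<-trans (proj₂ (within z z≤last)) β<pz)

  window-bound : ∀ j → WindowBound j
  window-bound j M a b b≤n cliques with a <? b
  ... | no a≮b = inj₂ (≤-<-trans (≮⇒≥ a≮b) (m<m+n a (m^n>0 (suc M) j)))
  window-bound zero M a b _ cliques | yes a<b =
    contradiction (cliques 1 (λ _ → a) (λ { {zero} {zero} _ → refl }) (λ _ → ≤-refl , a<b)
                    (λ { zero zero 0≢0 → contradiction refl 0≢0 }))
                  λ ()
  window-bound (suc j) M a b b≤n cliques | yes a<b
    with argmin-window ℚₚ.≤-totalPreorder R b a<b
       | argmin-window (Flip.totalPreorder ℚₚ.≤-totalPreorder) L b a<b
  ... | u , (a≤u , u<b) , u-ends-first | v , (a≤v , v<b) , v-starts-last with ≤-total u v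
  ... | inj₁ u≤v = let P = greedy-path u≤v (<-≤-trans v<b b≤n) in
    WindowStep.window-bound-step cliques P a≤u v<b
      (start-vertex P {EndsFirstIn a b} u-ends-first) (end-vertex P {StartsLastIn a b} v-starts-last)
      M b≤n (window-bound j)
  ... | inj₂ v≤u = let P = greedy-path v≤u (<-≤-trans u<b b≤n) in
    WindowStep.window-bound-step cliques P a≤v u<b
      (end-vertex P {EndsFirstIn a b} u-ends-first) (start-vertex P {StartsLastIn a b} v-starts-last)
      M b≤n (window-bound j)

bounded-ascent : ∀ {P Q : ℕ → Set} N → (∀ {m} → P m → m ≤ N) →
  (∀ M → (∃[ m ] M < m × P m) ⊎ Q M) → ∀ {m} → P m → ∃[ m ] P m × Q m
bounded-ascent {P} {Q} N bounded step {m} pm = climb N (m≤m+n N m) pm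
  where
  climb : ∀ fuel {m} → N ≤ fuel + m → P m → ∃[ m ] P m × Q m
  climb fuel {m} N≤fuel+m pm with step m
  ... | inj₂ qm = m , pm , qm
  climb zero         N≤m          _ | inj₁ (m′ , m<m′ , pm′) =
    contradiction (bounded pm′) (<⇒≱ (≤-<-trans N≤m m<m′))
  climb (suc fuel) {m} N≤fuel+m _ | inj₁ (m′ , m<m′ , pm′) =
    climb fuel (fuel-suffices N≤fuel+m m<m′) pm′

empty-induced-path : ∀ {n} (G : Graph n) → IsInducedPath {n} {0} G (λ ())
empty-induced-path G = ((λ { {()} }) , (λ ())) , (λ ())

module HamiltonianOrder {n} {{_ : NonZero n}} (G : Graph n)
  (l r : Fin n → ℚ) (l≤r : ∀ v → l v ℚ.≤ r v)
  (intersection : ∀ u v → u ≢ v → (Adj G u v ⇔ (l u ℚ.≤ r v × l v ℚ.≤ r u)))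
  (h : Fin n → Fin n) (h-path : IsPath G h) where

  -- Reducing modulo n only extends the order to all of ℕ; indices ≥ n are never used.
  vertex : ℕ → Fin n
  vertex i = h (i mod n)

  L R : ℕ → ℚ
  L = l ∘ vertex
  R = r ∘ vertex

  open Intervals L R using (Meets)

  toℕ-mod : ∀ {i} → i < n → toℕ (i mod n) ≡ i
  toℕ-mod {i} i<n = trans (toℕ-fromℕ< _) (m<n⇒m%n≡m i<n)

  vertex-injective : ∀ {i j} → i < n → j < n → vertex i ≡ vertex j → i ≡ j
  vertex-injective i<n j<n eq =
    trans (≡.sym (toℕ-mod i<n)) (trans (cong toℕ (proj₁ h-path eq)) (toℕ-mod j<n))

  adjacent⇒meets : ∀ i j → Adj G (vertex i) (vertex j) → Meets i j
  adjacent⇒meets i j adj =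
    Equivalence.to (intersection _ _ (λ eq → irrefl G (subst (Adj G (vertex i)) (≡.sym eq) adj))) adj

  meets⇒adjacent : ∀ {i j} → vertex i ≢ vertex j → Meets i j → Adj G (vertex i) (vertex j)
  meets⇒adjacent vi≢vj = Equivalence.from (intersection _ _ vi≢vj)

  consecutive-meet : ∀ i → suc i < n → Meets i (suc i)
  consecutive-meet i 1+i<n = adjacent⇒meets i (suc i) (proj₂ h-path (i mod n) (suc i mod n)
    (trans (toℕ-mod 1+i<n) (cong suc (≡.sym (toℕ-mod (<-trans (n<1+n i) 1+i<n))))))

  open IntervalSequence n L R (l≤r ∘ vertex) consecutive-meet

  clique-number : ∀ {k} → (∀ m (q : Fin m → Fin n) → IsClique G q → m ≤ k) → CliqueNumber≤ 0 n k
  clique-number maximal m K K-inj K-in K-meets = maximal m (vertex ∘ K) (injective , adjacent)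
    where
    injective : Injective _≡_ _≡_ (vertex ∘ K)
    injective eq = K-inj (vertex-injective (proj₂ (K-in _)) (proj₂ (K-in _)) eq)
    adjacent : ∀ x y → x ≢ y → Adj G (vertex (K x)) (vertex (K y))
    adjacent x y x≢y = meets⇒adjacent (x≢y ∘ injective) (K-meets x y x≢y)

  induced-path : ∀ {m p} → AscendingInducedPath m p → IsInducedPath G (vertex ∘ p ∘ toℕ)
  induced-path {m} {p} P = (injective , edges′) , chordless′
    where
    open AscendingInducedPath P
    p-injective : ∀ {x y} → x < m → y < m → p x ≡ p y → x ≡ y
    p-injective {x} {y} x<m y<m eq with <-cmp x y
    ... | tri< x<y _ _ = contradiction eq (<⇒≢ (ascending x y x<y y<m))
    ... | tri≈ _ x≡y _ = x≡y
    ... | tri> _ _ y<x = contradiction (≡.sym eq) (<⇒≢ (ascending y x y<x x<m))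
    injective : Injective _≡_ _≡_ (vertex ∘ p ∘ toℕ)
    injective {x} {y} eq = toℕ-injective (p-injective (toℕ<n x) (toℕ<n y)
      (vertex-injective (bounded _ (toℕ<n x)) (bounded _ (toℕ<n y)) eq))
    edges′ : ∀ (x y : Fin m) → toℕ y ≡ suc (toℕ x) → Adj G (vertex (p (toℕ x))) (vertex (p (toℕ y)))
    edges′ x y y≡1+x = meets⇒adjacent (λ eq → 1+n≢n (≡.sym (trans (cong toℕ (injective eq)) y≡1+x)))
      (subst (λ t → Meets (p (toℕ x)) (p t)) (≡.sym y≡1+x)
             (edges (toℕ x) (subst (_< m) y≡1+x (toℕ<n y))))
    chordless′ : ∀ (x y : Fin m) → Adj G (vertex (p (toℕ x))) (vertex (p (toℕ y))) →
      toℕ y ≡ suc (toℕ x) ⊎ toℕ x ≡ suc (toℕ y)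
    chordless′ x y adj with <-cmp (toℕ x) (toℕ y)
    ... | tri< x<y _ _ = inj₁ (chordless _ _ x<y (toℕ<n y) (adjacent⇒meets _ _ adj))
    ... | tri> _ _ y<x = inj₂ (chordless _ _ y<x (toℕ<n x) (swap (adjacent⇒meets _ _ adj)))
    ... | tri≈ _ x≡y _ with toℕ-injective x≡y
    ...   | refl = ⊥-elim (irrefl G adj)

  long-induced-path : ∀ {k} → CliqueNumber≤ 0 n k →
    ∃[ m ] Σ[ p ∈ (Fin m → Fin n) ] IsInducedPath G p × n < suc m ^ k
  long-induced-path {k} cliques =
    let m , (p , p-induced) , n< = bounded-ascent n size≤n longer-or-bounded (_ , empty-induced-path G)
    in m , p , p-induced , n<
    where
    InducedPathOfSize : ℕ → Set
    InducedPathOfSize m = Σ[ p ∈ (Fin m → Fin n) ] IsInducedPath G p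
    size≤n : ∀ {m} → InducedPathOfSize m → m ≤ n
    size≤n (_ , p-induced) = injective⇒≤ (proj₁ (proj₁ p-induced))
    longer-or-bounded : ∀ M → (∃[ m ] M < m × InducedPathOfSize m) ⊎ n < suc M ^ k
    longer-or-bounded M = Sum.map₁ (λ (m , M<m , _ , P) → m , M<m , _ , induced-path P)
                                   (window-bound k M 0 n ≤-refl cliques)

induced-path-polynomial-bound : ∀ {n k} (G : Graph n) →
  IsIntervalGraph G → HasHamiltonianPath G → MaxCliqueSize G k →
  ∃[ m ] Σ[ p ∈ (Fin m → Fin n) ] IsInducedPath G p × n < suc m ^ k
induced-path-polynomial-bound {zero} {k} G _ _ _ = 0 , (λ ()) , empty-induced-path G , m^n>0 1 k
induced-path-polynomial-bound {suc _} G (l , r , l≤r , intersection) (h , h-path , _) (_ , maximal) =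
  long-induced-path (clique-number maximal)
  where open HamiltonianOrder G l r l≤r intersection h h-path

1+n≤2^n : ∀ n → suc n ≤ 2 ^ n
1+n≤2^n zero    = ≤-refl
1+n≤2^n (suc n) =
  +-mono-≤ (m^n>0 2 n) (≤-trans (1+n≤2^n n) (≤-reflexive (≡.sym (+-identityʳ (2 ^ n)))))

m≤m^n : ∀ m {n} → 1 ≤ n → m ≤ m ^ n
m≤m^n zero    _   = z≤n
m≤m^n (suc m) 1≤n = ≤-trans (≤-reflexive (≡.sym (^-identityʳ (suc m)))) (^-monoʳ-≤ (suc m) 1≤n)

polynomial⇒tower : ∀ {n m k} → 2 ≤ k → n < suc m ^ k → n ≤ 2 ^ ((k * m) ^ ((k ∸ 1) ^ 2))
polynomial⇒tower {n} {m} {k@(suc (suc k′))} (s≤s (s≤s _)) n< = begin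
  n                              ≤⟨ <⇒≤ n< ⟩
  suc m ^ k                      ≤⟨ ^-monoˡ-≤ k (1+n≤2^n m) ⟩
  (2 ^ m) ^ k                    ≡⟨ ^-*-assoc 2 m k ⟩
  2 ^ (m * k)                    ≡⟨ cong (2 ^_) (*-comm m k) ⟩
  2 ^ (k * m)                    ≤⟨ ^-monoʳ-≤ 2 (m≤m^n (k * m) (m^n>0 (suc k′) 2)) ⟩
  2 ^ ((k * m) ^ ((k ∸ 1) ^ 2))  ∎
  where open ≤-Reasoning

theorem15 : (k : ℕ) → 2 ≤ k →
    Σ ℕ λ C → 1 ≤ C ×
      ((n : ℕ) (G : Graph n) → IsIntervalGraph G → HasHamiltonianPath G →
        MaxCliqueSize G k →
        Σ ℕ λ m → Σ (Fin m → Fin n) λ p →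
          IsInducedPath G p × n ≤ 2 ^ ((C * m) ^ ((k ∸ 1) ^ 2)))
theorem15 k 2≤k = k , ≤-trans (s≤s z≤n) 2≤k , λ n G interval hamiltonian clique →
  let m , p , p-induced , n< = induced-path-polynomial-bound G interval hamiltonian clique
  in m , p , p-induced , polynomial⇒tower 2≤k n<
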